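{- For every $n\in\mathbb N$, the map $$\varphi:C_{3,n}\to C_{3,4n+1},\qquad (-x-y,x,y)\mapsto(2(y+x)+1,\,-2x,\,-2y-1)$$ is a bijection.
   Context: $\mathbb N=\{0,1,2,\ldots\}$. A partition $\lambda$ is determined by its arm set $A^+(\lambda)=\{\lambda_i-i:1\le i\le s\}$ and leg set $L^+(\lambda)=\{\lambda^*_i-i:1\le i\le s\}$ ($s=\#\{i:\lambda_i\ge i\}$, $\lambda^*$ the conjugate); any two finite subsets of $\mathbb N$ of equal size are the leg and arm sets of a unique partition. For $c=(c_0,\ldots,c_{t-1})\in\mathbb Z^t$ with coordinate sum $0$, $\lambda_c$ is the partition with arm set $\{qt+j:0\le q<c_j\}$ and leg set $\{qt+t-j-1:0\le q<-c_j\}$ (over $0\le j\le t-1$). $C_{t,n}=\{c\in\mathbb Z^t:\sum c_j=0,\ |\lambda_c|=n\}$ (it is in bijection with the set of $t$-core partitions of $n$). Elements of $C_{3,n}$ are written $(c_0,c_1,c_2)=(-x-y,x,y)$. -}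

module Defs where

open import Data.Nat using (ℕ; zero; suc; _+_; _*_; _∸_)
open import Data.Integer as ℤ using (ℤ; +_; -[1+_])
open import Data.Fin using (Fin; toℕ)
open import Data.Vec using (Vec; lookup; []; _∷_; foldr)
open import Data.List using (List; length; map; concatMap; upTo; allFin)
open import Data.Nat.ListAction using (sum)
open import Data.Product using (_×_)
open import Relation.Binary.PropositionalEquality using (_≡_)

posPart : ℤ → ℕ
posPart (+ n)    = n
posPart -[1+ n ] = 0

negPart : ℤ → ℕ
negPart (+ n)    = 0
negPart -[1+ n ] = suc n

coordSum : ∀ {t} → Vec ℤ t → ℤ
coordSum = foldr _ ℤ._+_ (+ 0)

-- arm set of λ_c : { q t + j : 0 ≤ q < c_j }  (listed without repetition)
armSet : ∀ {t} → Vec ℤ t → List ℕ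
armSet {t} c =
  concatMap (λ j → map (λ q → q * t + toℕ j) (upTo (posPart (lookup c j)))) (allFin t)

-- leg set of λ_c : { q t + t - j - 1 : 0 ≤ q < -c_j }  (listed without repetition)
legSet : ∀ {t} → Vec ℤ t → List ℕ
legSet {t} c =
  concatMap (λ j → map (λ q → q * t + (t ∸ toℕ j ∸ 1)) (upTo (negPart (lookup c j)))) (allFin t)

-- |λ| for the partition with arm set A and leg set L (Frobenius coordinates
-- (a_1..a_s | l_1..l_s)) :  |λ| = s + Σ a_i + Σ l_i
partitionSize : List ℕ → List ℕ → ℕ
partitionSize A L = length A + sum A + sum L

sizeλ : ∀ {t} → Vec ℤ t → ℕ
sizeλ c = partitionSize (armSet c) (legSet c)

InC : (t n : ℕ) → Vec ℤ t → Set
InC t n c = (coordSum c ≡ + 0) × (sizeλ c ≡ n)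

φ : Vec ℤ 3 → Vec ℤ 3
φ (c₀ ∷ x ∷ y ∷ []) =
  ((+ 2) ℤ.* (y ℤ.+ x) ℤ.+ (+ 1)) ∷ (ℤ.- ((+ 2) ℤ.* x)) ∷ (ℤ.- ((+ 2) ℤ.* y) ℤ.- (+ 1)) ∷ []

module Submission where

-- For t = 3 the arms (or legs) of λ_c coming from one coordinate c_j form an arithmetic
-- progression of difference 3, which gives 2|λ_c| = Σ_j (3 c_j² + (2j − 1) c_j); on a
-- triple (−x−y, x, y) this reads |λ_c| = 3(x² + xy + y²) + x + 2y. The image
-- φ(−x−y, x, y) = (…, −2x, −2y−1) is again such a triple, of size 4|λ_c| + 1, and x, y
-- can be read off its last two coordinates. Conversely the size of (−q−r, q, r) is odd
-- only when q is even and r is odd, and these triples are exactly the image of φ.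

open import Defs
open import Data.Empty using (⊥-elim)
open import Data.List using (List; []; _∷_; _++_; [_]; map; length; upTo)
open import Data.List.Properties using (length-map; length-upTo; length-++; map-++; upTo-∷ʳ)
open import Data.Nat.ListAction using (sum)
open import Data.Nat.ListAction.Properties using (sum-++)
open import Data.Product using (_×_; _,_; Σ-syntax; ∃-syntax)
open import Data.Sum using (_⊎_; inj₁; inj₂)
open import Data.Vec using (Vec; _∷_; [])
import Data.Vec.Properties as Vec
open import Function using (_∘_)
open import Relation.Binary.PropositionalEquality using (_≡_; _≢_; refl; sym; trans; cong; cong₂)
open Relation.Binary.PropositionalEquality.≡-Reasoning
import Data.Nat as ℕ
import Data.Nat.Properties as ℕ
open import Data.Integer as ℤ using (ℤ)

-- The two anonymous modules keep the arithmetic operators of ℕ and ℤ apart.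
module _ where
  open import Data.Nat using (ℕ; zero; suc; _+_; _*_)
  open import Data.Nat.Properties using (+-identityʳ)
  open import Data.Nat.Tactic.RingSolver using (solve-∀)

  progression : (t r k : ℕ) → List ℕ
  progression t r k = map (λ q → q * t + r) (upTo k)

  length-progression : ∀ t r k → length (progression t r k) ≡ k
  length-progression t r k = trans (length-map _ (upTo k)) (length-upTo k)

  sum-progression-suc : ∀ t r k → sum (progression t r (suc k)) ≡ sum (progression t r k) + (k * t + r)
  sum-progression-suc t r k = begin
    sum (map f (upTo (suc k)))          ≡⟨ cong (sum ∘ map f) (sym (upTo-∷ʳ k)) ⟩
    sum (map f (upTo k ++ [ k ]))       ≡⟨ cong sum (map-++ f (upTo k) [ k ]) ⟩
    sum (map f (upTo k) ++ [ f k ])     ≡⟨ sum-++ (map f (upTo k)) [ f k ] ⟩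
    sum (map f (upTo k)) + (f k + 0)    ≡⟨ cong (sum (map f (upTo k)) +_) (+-identityʳ (f k)) ⟩
    sum (map f (upTo k)) + f k          ∎
    where
    f : ℕ → ℕ
    f q = q * t + r

  sum-progression : ∀ t r k → 2 * sum (progression t r k) + t * k ≡ t * k * k + 2 * r * k
  sum-progression t r zero = empty t r
    where
    empty : ∀ t r → 2 * 0 + t * 0 ≡ t * 0 * 0 + 2 * r * 0
    empty = solve-∀
  sum-progression t r (suc k) = begin
    2 * sum (progression t r (suc k)) + t * suc k  ≡⟨ cong (λ s → 2 * s + t * suc k) (sum-progression-suc t r k) ⟩
    2 * (S + (k * t + r)) + t * suc k              ≡⟨ regroup t r k S ⟩
    (2 * S + t * k) + (2 * k * t + 2 * r + t)      ≡⟨ cong (_+ (2 * k * t + 2 * r + t)) (sum-progression t r k) ⟩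
    t * k * k + 2 * r * k + (2 * k * t + 2 * r + t) ≡⟨ expand t r k ⟩
    t * suc k * suc k + 2 * r * suc k              ∎
    where
    S : ℕ
    S = sum (progression t r k)
    regroup : ∀ t r k S → 2 * (S + (k * t + r)) + t * suc k ≡ (2 * S + t * k) + (2 * k * t + 2 * r + t)
    regroup = solve-∀
    expand : ∀ t r k → t * k * k + 2 * r * k + (2 * k * t + 2 * r + t) ≡ t * suc k * suc k + 2 * r * suc k
    expand = solve-∀

  partitionSize-++ : ∀ A A′ L L′ → partitionSize (A ++ A′) (L ++ L′) ≡ partitionSize A L + partitionSize A′ L′
  partitionSize-++ A A′ L L′
    rewrite length-++ A {A′} | sum-++ A A′ | sum-++ L L′
    = shuffle (length A) (length A′) (sum A) (sum A′) (sum L) (sum L′)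
    where
    shuffle : ∀ a a′ s s′ l l′ → a + a′ + (s + s′) + (l + l′) ≡ a + s + l + (a′ + s′ + l′)
    shuffle = solve-∀

  -- What a coordinate c_j contributes to |λ_c|, for r = j and r′ = t − j − 1.
  contribution : (t r r′ : ℕ) → ℤ → ℕ
  contribution t r r′ z = partitionSize (progression t r (posPart z)) (progression t r′ (negPart z))

  twice-contribution-pos : ∀ t r r′ k → 2 * contribution t r r′ (ℤ.+ k) + t * k ≡ t * k * k + 2 * suc r * k
  twice-contribution-pos t r r′ k = begin
    2 * (length (progression t r k) + S + 0) + t * k ≡⟨ cong (λ ℓ → 2 * (ℓ + S + 0) + t * k) (length-progression t r k) ⟩
    2 * (k + S + 0) + t * k                          ≡⟨ regroup t k S ⟩
    (2 * S + t * k) + 2 * k                          ≡⟨ cong (_+ 2 * k) (sum-progression t r k) ⟩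
    t * k * k + 2 * r * k + 2 * k                    ≡⟨ collect t r k ⟩
    t * k * k + 2 * suc r * k                        ∎
    where
    S : ℕ
    S = sum (progression t r k)
    regroup : ∀ t k S → 2 * (k + S + 0) + t * k ≡ (2 * S + t * k) + 2 * k
    regroup = solve-∀
    collect : ∀ t r k → t * k * k + 2 * r * k + 2 * k ≡ t * k * k + 2 * suc r * k
    collect = solve-∀

  twice-contribution-neg : ∀ t r r′ m →
    2 * contribution t r r′ ℤ.-[1+ m ] + t * suc m ≡ t * suc m * suc m + 2 * r′ * suc m
  twice-contribution-neg t r r′ m = sum-progression t r′ (suc m)

  sizeλ-three : ∀ a b e →
    sizeλ (a ∷ b ∷ e ∷ []) ≡ contribution 3 0 2 a + (contribution 3 1 1 b + contribution 3 2 0 e)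
  sizeλ-three a b e =
    trans (partitionSize-++ (arms 0 a) _ (legs 2 a) _)
      (cong (contribution 3 0 2 a +_)
        (trans (partitionSize-++ (arms 1 b) _ (legs 1 b) _)
          (cong (contribution 3 1 1 b +_)
            (trans (partitionSize-++ (arms 2 e) [] (legs 0 e) []) (+-identityʳ _)))))
    where
    arms legs : ℕ → ℤ → List ℕ
    arms r z = progression 3 r (posPart z)
    legs r z = progression 3 r (negPart z)

module _ where
  open import Data.Integer using (+_; -[1+_]; _+_; _-_; _*_; -_; _%_; _/_)
  open import Data.Integer.Properties using (pos-+; pos-*; +-injective; neg-injective; *-cancelˡ-≡)
  open import Data.Integer.DivMod using (a≡a%n+[a/n]*n; n%d<d)
  open import Data.Integer.Tactic.RingSolver using (solve-∀)

  twice-from-ℕ : ∀ c t s k → 2 ℕ.* c ℕ.+ t ℕ.* k ≡ t ℕ.* k ℕ.* k ℕ.+ 2 ℕ.* s ℕ.* k →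
                 + 2 * + c ≡ + t * + k * + k + (+ 2 * + s - + t) * + k
  twice-from-ℕ c t s k eq = begin
    + 2 * + c                                       ≡⟨ move (+ 2 * + c) (+ t * + k) ⟩
    (+ 2 * + c + + t * + k) - + t * + k             ≡⟨ cong (_- + t * + k) (sym lhs) ⟩
    + (2 ℕ.* c ℕ.+ t ℕ.* k) - + t * + k              ≡⟨ cong (λ n → + n - + t * + k) eq ⟩
    + (t ℕ.* k ℕ.* k ℕ.+ 2 ℕ.* s ℕ.* k) - + t * + k  ≡⟨ cong (_- + t * + k) rhs ⟩
    (+ t * + k * + k + + 2 * + s * + k) - + t * + k ≡⟨ collect (+ t) (+ s) (+ k) ⟩
    + t * + k * + k + (+ 2 * + s - + t) * + k       ∎
    where
    move : ∀ x y → x ≡ (x + y) - y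
    move = solve-∀
    collect : ∀ t s k → (t * k * k + + 2 * s * k) - t * k ≡ t * k * k + (+ 2 * s - t) * k
    collect = solve-∀
    lhs : + (2 ℕ.* c ℕ.+ t ℕ.* k) ≡ + 2 * + c + + t * + k
    lhs = trans (pos-+ (2 ℕ.* c) _) (cong₂ _+_ (pos-* 2 c) (pos-* t k))
    rhs : + (t ℕ.* k ℕ.* k ℕ.+ 2 ℕ.* s ℕ.* k) ≡ + t * + k * + k + + 2 * + s * + k
    rhs = trans (pos-+ (t ℕ.* k ℕ.* k) _)
            (cong₂ _+_ (trans (pos-* (t ℕ.* k) k) (cong (_* + k) (pos-* t k)))
                       (trans (pos-* (2 ℕ.* s) k) (cong (_* + k) (pos-* 2 s))))

  pos-period : ∀ r r′ {t} → r ℕ.+ r′ ℕ.+ 1 ≡ t → + t ≡ + r + + r′ + + 1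
  pos-period r r′ refl = trans (pos-+ (r ℕ.+ r′) 1) (cong (_+ + 1) (pos-+ r r′))

  twice-contribution : ∀ t r r′ → r ℕ.+ r′ ℕ.+ 1 ≡ t →
                       ∀ z → + 2 * + contribution t r r′ z ≡ + t * z * z + (+ r - + r′ + + 1) * z
  twice-contribution t r r′ r+r′+1≡t (+ k) = begin
    + 2 * + C
      ≡⟨ twice-from-ℕ C t (ℕ.suc r) k (twice-contribution-pos t r r′ k) ⟩
    + t * K * K + (+ 2 * + ℕ.suc r - + t) * K
      ≡⟨ cong₂ (λ S T → + t * K * K + (+ 2 * S - T) * K) (pos-+ 1 r) (pos-period r r′ r+r′+1≡t) ⟩
    + t * K * K + (+ 2 * (+ 1 + + r) - (+ r + + r′ + + 1)) * K
      ≡⟨ collect (+ t) (+ r) (+ r′) K ⟩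
    + t * K * K + (+ r - + r′ + + 1) * K
      ∎
    where
    C : ℕ.ℕ
    C = contribution t r r′ (+ k)
    K : ℤ
    K = + k
    collect : ∀ t r r′ k → t * k * k + (+ 2 * (+ 1 + r) - (r + r′ + + 1)) * k ≡ t * k * k + (r - r′ + + 1) * k
    collect = solve-∀
  twice-contribution t r r′ r+r′+1≡t -[1+ m ] = begin
    + 2 * + C
      ≡⟨ twice-from-ℕ C t r′ (ℕ.suc m) (twice-contribution-neg t r r′ m) ⟩
    + t * K * K + (+ 2 * + r′ - + t) * K
      ≡⟨ cong (λ T → + t * K * K + (+ 2 * + r′ - T) * K) (pos-period r r′ r+r′+1≡t) ⟩
    + t * K * K + (+ 2 * + r′ - (+ r + + r′ + + 1)) * K
      ≡⟨ collect (+ t) (+ r) (+ r′) K ⟩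
    + t * (- K) * (- K) + (+ r - + r′ + + 1) * (- K)
      ∎
    where
    C : ℕ.ℕ
    C = contribution t r r′ -[1+ m ]
    K : ℤ
    K = + ℕ.suc m
    collect : ∀ t r r′ k → t * k * k + (+ 2 * r′ - (r + r′ + + 1)) * k ≡ t * (- k) * (- k) + (r - r′ + + 1) * (- k)
    collect = solve-∀

  triple : ℤ → ℤ → Vec ℤ 3
  triple x y = - (x + y) ∷ x ∷ y ∷ []

  tripleSize : ℤ → ℤ → ℤ
  tripleSize x y = + 3 * (x * x + x * y + y * y) + x + + 2 * y
  -- Inlined so that the ring solver sees the polynomial.
  {-# INLINE tripleSize #-}

  sizeλ-triple : ∀ x y → + sizeλ (triple x y) ≡ tripleSize x y
  sizeλ-triple x y = *-cancelˡ-≡ (+ 2) _ _ (begin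
    + 2 * + sizeλ (triple x y)
      ≡⟨ cong (λ s → + 2 * + s) (sizeλ-three a x y) ⟩
    + 2 * + (c₀ ℕ.+ (c₁ ℕ.+ c₂))
      ≡⟨ cong (+ 2 *_) (trans (pos-+ c₀ _) (cong (λ s → + c₀ + s) (pos-+ c₁ c₂))) ⟩
    + 2 * (+ c₀ + (+ c₁ + + c₂))
      ≡⟨ distribute (+ c₀) (+ c₁) (+ c₂) ⟩
    + 2 * + c₀ + (+ 2 * + c₁ + + 2 * + c₂)
      ≡⟨ cong₂ _+_ (twice-contribution 3 0 2 refl a)
           (cong₂ _+_ (twice-contribution 3 1 1 refl x) (twice-contribution 3 2 0 refl y)) ⟩
    (+ 3 * a * a + (+ 0 - + 2 + + 1) * a)
      + ((+ 3 * x * x + (+ 1 - + 1 + + 1) * x) + (+ 3 * y * y + (+ 2 - + 0 + + 1) * y))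
      ≡⟨ collect x y ⟩
    + 2 * tripleSize x y
      ∎)
    where
    a : ℤ
    a = - (x + y)
    c₀ c₁ c₂ : ℕ.ℕ
    c₀ = contribution 3 0 2 a
    c₁ = contribution 3 1 1 x
    c₂ = contribution 3 2 0 y
    distribute : ∀ u v w → + 2 * (u + (v + w)) ≡ + 2 * u + (+ 2 * v + + 2 * w)
    distribute = solve-∀
    collect : ∀ x y → (+ 3 * (- (x + y)) * (- (x + y)) + (+ 0 - + 2 + + 1) * (- (x + y)))
                        + ((+ 3 * x * x + (+ 1 - + 1 + + 1) * x) + (+ 3 * y * y + (+ 2 - + 0 + + 1) * y))
                      ≡ + 2 * tripleSize x y
    collect = solve-∀

  φ-triple : ∀ x y → φ (triple x y) ≡ triple (- (+ 2 * x)) (- (+ 2 * y) - + 1)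
  φ-triple x y = cong (_∷ (- (+ 2 * x) ∷ - (+ 2 * y) - + 1 ∷ [])) (first x y)
    where
    first : ∀ x y → + 2 * (y + x) + + 1 ≡ - (- (+ 2 * x) + (- (+ 2 * y) - + 1))
    first = solve-∀

  tripleSize-φ : ∀ x y → tripleSize (- (+ 2 * x)) (- (+ 2 * y) - + 1) ≡ + 4 * tripleSize x y + + 1
  tripleSize-φ = solve-∀

  sizeλ-φ-triple : ∀ x y → sizeλ (φ (triple x y)) ≡ 4 ℕ.* sizeλ (triple x y) ℕ.+ 1
  sizeλ-φ-triple x y = +-injective (begin
    + sizeλ (φ (triple x y))          ≡⟨ cong (+_ ∘ sizeλ) (φ-triple x y) ⟩
    + sizeλ (triple x′ y′)            ≡⟨ sizeλ-triple x′ y′ ⟩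
    tripleSize x′ y′                  ≡⟨ tripleSize-φ x y ⟩
    + 4 * tripleSize x y + + 1        ≡⟨ cong (λ s → + 4 * s + + 1) (sym (sizeλ-triple x y)) ⟩
    + 4 * + s + + 1                   ≡⟨ sym (trans (pos-+ (4 ℕ.* s) 1) (cong (_+ + 1) (pos-* 4 s))) ⟩
    + (4 ℕ.* s ℕ.+ 1)                 ∎)
    where
    x′ y′ : ℤ
    x′ = - (+ 2 * x)
    y′ = - (+ 2 * y) - + 1
    s : ℕ.ℕ
    s = sizeλ (triple x y)

  coordSum-triple : ∀ x y → coordSum (triple x y) ≡ + 0
  coordSum-triple = cancel
    where
    cancel : ∀ x y → - (x + y) + (x + (y + + 0)) ≡ + 0
    cancel = solve-∀

  coordSum≡0⇒head : ∀ a b e → coordSum (a ∷ b ∷ e ∷ []) ≡ + 0 → a ≡ - (b + e)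
  coordSum≡0⇒head a b e sum≡0 = begin
    a                                   ≡⟨ isolate a b e ⟩
    (a + (b + (e + + 0))) - (b + e)     ≡⟨ cong (_- (b + e)) sum≡0 ⟩
    + 0 - (b + e)                       ≡⟨ subtract (b + e) ⟩
    - (b + e)                           ∎
    where
    isolate : ∀ a b e → a ≡ (a + (b + (e + + 0))) - (b + e)
    isolate = solve-∀
    subtract : ∀ s → + 0 - s ≡ - s
    subtract = solve-∀

  ℤ-parity : ∀ z → (∃[ u ] z ≡ + 2 * u) ⊎ (∃[ u ] z ≡ + 2 * u + + 1)
  ℤ-parity z with z % + 2 | n%d<d z (+ 2) | a≡a%n+[a/n]*n z (+ 2)
  ... | 0 | _ | z≡ = inj₁ (z / + 2 , trans z≡ (even (z / + 2)))
    where
    even : ∀ u → + 0 + u * + 2 ≡ + 2 * u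
    even = solve-∀
  ... | 1 | _ | z≡ = inj₂ (z / + 2 , trans z≡ (odd (z / + 2)))
    where
    odd : ∀ u → + 1 + u * + 2 ≡ + 2 * u + + 1
    odd = solve-∀
  ... | ℕ.suc (ℕ.suc _) | ℕ.s≤s (ℕ.s≤s ()) | _

  odd≢even : ∀ m u → + (1 ℕ.+ 2 ℕ.* m) ≢ + 2 * u
  odd≢even m (+ k) eq = ℕ.even≢odd k m (sym (+-injective (trans eq (sym (pos-* 2 k)))))
  odd≢even m -[1+ k ] ()

  tripleSize-odd : ∀ m q r → tripleSize q r ≡ + (1 ℕ.+ 2 ℕ.* m) →
                   ∃[ u ] ∃[ v ] (q ≡ + 2 * u × r ≡ + 2 * v + + 1)
  tripleSize-odd m q r size≡odd with ℤ-parity q | ℤ-parity r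
  ... | inj₁ (u , refl) | inj₂ (v , refl) = u , v , refl , refl
  ... | inj₁ (u , refl) | inj₁ (v , refl) = ⊥-elim (odd≢even m _ (trans (sym size≡odd) (even-even u v)))
    where
    even-even : ∀ u v → tripleSize (+ 2 * u) (+ 2 * v) ≡ + 2 * (+ 6 * (u * u + u * v + v * v) + u + + 2 * v)
    even-even = solve-∀
  ... | inj₂ (u , refl) | inj₁ (v , refl) = ⊥-elim (odd≢even m _ (trans (sym size≡odd) (odd-even u v)))
    where
    odd-even : ∀ u v → tripleSize (+ 2 * u + + 1) (+ 2 * v)
                       ≡ + 2 * (+ 6 * (u * u + u * v + v * v) + + 7 * u + + 5 * v + + 2)
    odd-even = solve-∀
  ... | inj₂ (u , refl) | inj₂ (v , refl) = ⊥-elim (odd≢even m _ (trans (sym size≡odd) (odd-odd u v)))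
    where
    odd-odd : ∀ u v → tripleSize (+ 2 * u + + 1) (+ 2 * v + + 1)
                      ≡ + 2 * (+ 6 * (u * u + u * v + v * v) + + 10 * u + + 11 * v + + 6)
    odd-odd = solve-∀

  φ-into : ∀ n c → InC 3 n c → InC 3 (4 ℕ.* n ℕ.+ 1) (φ c)
  φ-into n (a ∷ x ∷ y ∷ []) (sum≡0 , size≡n) with coordSum≡0⇒head a x y sum≡0
  ... | refl = trans (cong coordSum (φ-triple x y)) (coordSum-triple (- (+ 2 * x)) (- (+ 2 * y) - + 1))
             , trans (sizeλ-φ-triple x y) (cong (λ s → 4 ℕ.* s ℕ.+ 1) size≡n)

  φ-injective : ∀ n c c′ → InC 3 n c → InC 3 n c′ → φ c ≡ φ c′ → c ≡ c′
  φ-injective n (a ∷ x ∷ y ∷ []) (a′ ∷ x′ ∷ y′ ∷ []) (sum≡0 , _) (sum′≡0 , _) φc≡φc′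
    with coordSum≡0⇒head a x y sum≡0 | coordSum≡0⇒head a′ x′ y′ sum′≡0
  ... | refl | refl = cong₂ triple x≡x′ y≡y′
    where
    tails : - (+ 2 * x) ∷ - (+ 2 * y) - + 1 ∷ [] ≡ - (+ 2 * x′) ∷ - (+ 2 * y′) - + 1 ∷ []
    tails = Vec.∷-injectiveʳ φc≡φc′
    recover : ∀ y → + 2 * y ≡ - ((- (+ 2 * y) - + 1) + + 1)
    recover = solve-∀
    x≡x′ : x ≡ x′
    x≡x′ = *-cancelˡ-≡ (+ 2) x x′ (neg-injective (Vec.∷-injectiveˡ tails))
    third : - (+ 2 * y) - + 1 ≡ - (+ 2 * y′) - + 1
    third = Vec.∷-injectiveˡ (Vec.∷-injectiveʳ tails)
    y≡y′ : y ≡ y′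
    y≡y′ = *-cancelˡ-≡ (+ 2) y y′
             (trans (recover y) (trans (cong (λ w → - (w + + 1)) third) (sym (recover y′))))

  φ-onto : ∀ n d → InC 3 (4 ℕ.* n ℕ.+ 1) d → Σ[ c ∈ Vec ℤ 3 ] (InC 3 n c × φ c ≡ d)
  φ-onto n (a ∷ q ∷ r ∷ []) (sum≡0 , size≡) with coordSum≡0⇒head a q r sum≡0
  ... | refl with tripleSize-odd (2 ℕ.* n) q r (trans (sym (sizeλ-triple q r)) (cong +_ (trans size≡ 4n+1≡odd)))
    where
    4n+1≡odd : 4 ℕ.* n ℕ.+ 1 ≡ 1 ℕ.+ 2 ℕ.* (2 ℕ.* n)
    4n+1≡odd = trans (ℕ.+-comm (4 ℕ.* n) 1) (cong (1 ℕ.+_) (ℕ.*-assoc 2 2 n))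
  ... | u , v , refl , refl = c , (coordSum-triple (- u) (- v - + 1) , size≡n) , φc≡d
    where
    c : Vec ℤ 3
    c = triple (- u) (- v - + 1)
    even-part : ∀ u → - (+ 2 * - u) ≡ + 2 * u
    even-part = solve-∀
    odd-part : ∀ v → - (+ 2 * (- v - + 1)) - + 1 ≡ + 2 * v + + 1
    odd-part = solve-∀
    φc≡d : φ c ≡ triple (+ 2 * u) (+ 2 * v + + 1)
    φc≡d = trans (φ-triple (- u) (- v - + 1)) (cong₂ triple (even-part u) (odd-part v))
    size≡n : sizeλ c ≡ n
    size≡n = ℕ.*-cancelˡ-≡ _ _ 4 (ℕ.+-cancelʳ-≡ 1 _ _
               (trans (sym (sizeλ-φ-triple (- u) (- v - + 1))) (trans (cong sizeλ φc≡d) size≡)))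

open import Data.Nat using (ℕ; _+_; _*_)

corollary5p3 : (n : ℕ) →
    ((c : Vec ℤ 3) → InC 3 n c → InC 3 (4 * n + 1) (φ c))
    × ((c c′ : Vec ℤ 3) → InC 3 n c → InC 3 n c′ → φ c ≡ φ c′ → c ≡ c′)
    × ((d : Vec ℤ 3) → InC 3 (4 * n + 1) d → Σ[ c ∈ Vec ℤ 3 ] (InC 3 n c × φ c ≡ d))
corollary5p3 n = φ-into n , φ-injective n , φ-onto n
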